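{- Losanitsch's triangle $(L(n,k))_{n,k\ge 0}$ is the unique infinite matrix $(a(n,k))_{n,k\ge0}$ with the following two properties: (i) for each $k\ge0$, the column $(a(n,k))_{n\ge0}$ equals either $(e(n,k))_{n\ge0}$ or $(o(n,k))_{n\ge0}$; (ii) $a(n,n)=1$ for all $n\ge 0$.
   Context: $e(n,k)$ (resp. $o(n,k)$) is the number of $k$-subsets of $\{1,\dots,n\}$ whose element sum is even (resp. odd); the empty set counts as even, and both are $0$ for $k<0$ or $k>n$. Losanitsch's triangle is defined by $L(0,k)=[k=0]$, $L(1,k)=[0\le k\le 1]$, $L(n,k)=0$ for $k<0$, and for $n\ge 2$ by $L(n,k)=L(n-2,k)+\binom{n-2}{k-1}+L(n-2,k-2)$ (with $\binom{m}{j}=0$ for $j<0$ or $j>m$). -}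

module Defs where

open import Data.Nat using (ℕ; zero; suc; _+_; _%_; _≟_)
open import Data.Nat.Combinatorics using (_C_)
open import Data.List using (List; []; _∷_; _++_; map; length; filter)
open import Data.Nat.ListAction using (sum)
open import Data.Sum using (_⊎_)
open import Data.Product using (_×_)
open import Relation.Nullary.Decidable using (_×-dec_)
open import Relation.Binary.PropositionalEquality using (_≡_)

ground : ℕ → List ℕ
ground zero    = []
ground (suc n) = suc n ∷ ground n

-- all subsets of (the set of elements of) a duplicate-free list, each as a list
subsets : List ℕ → List (List ℕ)
subsets []       = [] ∷ []
subsets (x ∷ xs) = subsets xs ++ map (x ∷_) (subsets xs)

e : ℕ → ℕ → ℕ
e n k = length (filter (λ s → (length s ≟ k) ×-dec (sum s % 2 ≟ 0)) (subsets (ground n)))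

o : ℕ → ℕ → ℕ
o n k = length (filter (λ s → (length s ≟ k) ×-dec (sum s % 2 ≟ 1)) (subsets (ground n)))

-- Losanitsch's triangle: L(0,k)=[k=0], L(1,k)=[k≤1],
-- L(n,k) = L(n-2,k) + C(n-2,k-1) + L(n-2,k-2)  (terms with negative index are 0)
L : ℕ → ℕ → ℕ
L zero          zero             = 1
L zero          (suc k)          = 0
L (suc zero)    zero             = 1
L (suc zero)    (suc zero)       = 1
L (suc zero)    (suc (suc k))    = 0
L (suc (suc n)) zero             = L n zero
L (suc (suc n)) (suc zero)       = L n (suc zero) + n C zero
L (suc (suc n)) (suc (suc k))    = L n (suc (suc k)) + n C (suc k) + L n k

ColumnsEO : (ℕ → ℕ → ℕ) → Set
ColumnsEO a = ∀ k → (∀ n → a n k ≡ e n k) ⊎ (∀ n → a n k ≡ o n k)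

DiagOne : (ℕ → ℕ → ℕ) → Set
DiagOne a = ∀ n → a n n ≡ 1

module Submission where

-- Write c(k) for the parity of 1 + 2 + ⋯ + k.  The theorem says that column k
-- of Losanitsch's triangle counts the k-subsets of {1,…,n} whose sum has
-- parity c(k), and that no other choice of parities gives diagonal entries 1.
--
-- Splitting off the first element x gives the Pascal-type
-- recursion  count b (k+1) (x ∷ xs) = count b (k+1) xs + count (odd x xor b) k xs,
-- from which three facts follow: the two parity classes together give the
-- binomial coefficient; a list of length m has exactly one m-subset, of
-- parity odd (sum xs), and no larger subsets; and peeling two consecutive
-- numbers off the list yields exactly Losanitsch's recurrence, the middle
-- term being a full binomial coefficient.  Since c(k+2) = not c(k) these
-- combine to  L n k = count (c k) k {1,…,n}, giving existence and the
-- diagonal; uniqueness holds because the diagonal entry 1 forces the parity.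

open import Defs
open import Data.Bool using (Bool; true; false; not; _xor_; _∧_)
open import Data.Bool.Properties using (not-involutive; not-distribˡ-xor; not-distribʳ-xor; ¬-not)
  renaming (_≟_ to _≟ᵇ_)
open import Data.Nat using (ℕ; zero; suc; _+_; _%_; _≟_; _<_; s≤s)
open import Data.Nat.Properties
  using (+-comm; +-assoc; +-identityʳ; m<n⇒m<1+n; n<1+n; +-commutativeSemigroup)
open import Algebra.Properties.CommutativeSemigroup +-commutativeSemigroup using (interchange)
open import Data.Nat.DivMod using ([m+n]%n≡m%n)
open import Data.Nat.Combinatorics using (_C_; nCn≡1; nCk+nC[k+1]≡[n+1]C[k+1])
open import Data.Nat.ListAction using (sum)
open import Data.List using (List; []; _∷_; _++_; map; length; filter)
open import Data.List.Properties using (length-++; filter-++; filter-none)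
open import Data.List.Relation.Unary.All using (universal)
open import Data.Product using (Σ; _×_; _,_)
open import Data.Sum using (_⊎_; inj₁; inj₂)
open import Function using (_∘_)
open import Relation.Nullary using (Dec; does; yes; no; contradiction)
open import Relation.Nullary.Decidable using (_×-dec_)
open import Relation.Unary using (Pred; Decidable)
open import Relation.Binary.PropositionalEquality
open ≡-Reasoning

odd : ℕ → Bool
odd zero    = false
odd (suc n) = not (odd n)

bit : Bool → ℕ
bit false = 0
bit true  = 1

%2≡bit-odd : ∀ m → m % 2 ≡ bit (odd m)
%2≡bit-odd zero          = refl
%2≡bit-odd (suc zero)    = refl
%2≡bit-odd (suc (suc m)) = begin
  suc (suc m) % 2          ≡⟨ cong (_% 2) (+-comm 2 m) ⟩
  (m + 2) % 2              ≡⟨ [m+n]%n≡m%n m 2 ⟩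
  m % 2                    ≡⟨ %2≡bit-odd m ⟩
  bit (odd m)              ≡⟨ cong bit (sym (not-involutive (odd m))) ⟩
  bit (not (not (odd m)))  ∎

odd-+ : ∀ x m → odd (x + m) ≡ odd x xor odd m
odd-+ zero    m = refl
odd-+ (suc x) m = trans (cong not (odd-+ x m)) (not-distribˡ-xor (odd x) (odd m))

opposite-xor : ∀ {p q} c → p ≡ not q → q xor (p xor c) ≡ not c
opposite-xor {q = false} c refl = refl
opposite-xor {q = true}  c refl = refl

opposite-flip : ∀ {p q} b → p ≡ not q → p xor b ≡ not (q xor b)
opposite-flip {q = q} b refl = sym (not-distribˡ-xor q b)

-- Adding x to a sum shifts the parity test by the parity of x; this is the
-- only arithmetic input of the whole argument.
parity-shift : ∀ x m b → does ((x + m) % 2 ≟ bit b) ≡ does (m % 2 ≟ bit (odd x xor b))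
parity-shift x m b rewrite %2≡bit-odd (x + m) | %2≡bit-odd m | odd-+ x m =
  shift (odd x) (odd m) b
  where
  shift : ∀ p q b → does (bit (p xor q) ≟ bit b) ≡ does (bit q ≟ bit (p xor b))
  shift false q     b     = refl
  shift true  false false = refl
  shift true  false true  = refl
  shift true  true  false = refl
  shift true  true  true  = refl

length-filter-map : ∀ {A B : Set} {ℓ} {P : Pred B ℓ} (P? : Decidable P) (f : A → B) xs →
  length (filter P? (map f xs)) ≡ length (filter (P? ∘ f) xs)
length-filter-map P? f []       = refl
length-filter-map P? f (x ∷ xs) with does (P? (f x))
... | true  = cong suc (length-filter-map P? f xs)
... | false = length-filter-map P? f xs

length-filter-cong : ∀ {A : Set} {ℓ} {P Q : Pred A ℓ} (P? : Decidable P) (Q? : Decidable Q) →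
  (∀ a → does (P? a) ≡ does (Q? a)) → ∀ xs → length (filter P? xs) ≡ length (filter Q? xs)
length-filter-cong P? Q? same []       = refl
length-filter-cong P? Q? same (x ∷ xs) with does (P? x) | does (Q? x) | same x
... | true  | true  | refl = cong suc (length-filter-cong P? Q? same xs)
... | false | false | refl = length-filter-cong P? Q? same xs

shape? : (b : Bool) (k : ℕ) (s : List ℕ) → Dec (length s ≡ k × sum s % 2 ≡ bit b)
shape? b k s = (length s ≟ k) ×-dec (sum s % 2 ≟ bit b)

-- count b k xs : the number of k-subsets of xs whose sum has parity b.
-- By definition e n k = count false k (ground n) and o n k = count true k (ground n).
count : Bool → ℕ → List ℕ → ℕ
count b k xs = length (filter (shape? b k) (subsets xs))

count-split : ∀ b k x xs →
  count b k (x ∷ xs) ≡ count b k xs + length (filter (shape? b k ∘ (x ∷_)) (subsets xs))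
count-split b k x xs = begin
  length (filter P? (S ++ map (x ∷_) S))              ≡⟨ cong length (filter-++ P? S _) ⟩
  length (filter P? S ++ filter P? (map (x ∷_) S))    ≡⟨ length-++ (filter P? S) ⟩
  count b k xs + length (filter P? (map (x ∷_) S))    ≡⟨ cong (count b k xs +_) (length-filter-map P? (x ∷_) S) ⟩
  count b k xs + length (filter (P? ∘ (x ∷_)) S)      ∎
  where
  S  = subsets xs
  P? = shape? b k

-- A subset containing x is never empty.
count-cons-zero : ∀ b x xs → count b 0 (x ∷ xs) ≡ count b 0 xs
count-cons-zero b x xs = begin
  count b 0 (x ∷ xs)                                   ≡⟨ count-split b 0 x xs ⟩
  count b 0 xs + length (filter nonempty? (subsets xs)) ≡⟨ cong (λ l → count b 0 xs + length l) none ⟩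
  count b 0 xs + 0                                     ≡⟨ +-identityʳ _ ⟩
  count b 0 xs                                         ∎
  where
  nonempty? = shape? b 0 ∘ (x ∷_)
  none : filter nonempty? (subsets xs) ≡ []
  none = filter-none nonempty? (universal (λ _ ()) (subsets xs))

-- Pascal's rule refined by parity: a (k+1)-subset containing x is x added
-- to a k-subset of xs whose sum has parity shifted by x.
count-cons-suc : ∀ b k x xs → count b (suc k) (x ∷ xs) ≡ count b (suc k) xs + count (odd x xor b) k xs
count-cons-suc b k x xs = trans (count-split b (suc k) x xs)
  (cong (count b (suc k) xs +_) (length-filter-cong _ _ shifted (subsets xs)))
  where
  shifted : ∀ s → does (shape? b (suc k) (x ∷ s)) ≡ does (shape? (odd x xor b) k s)
  shifted s = cong (does (length s ≟ k) ∧_) (parity-shift x (sum s) b)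

count-total : ∀ b k xs → count b k xs + count (not b) k xs ≡ length xs C k
count-total false zero    []       = refl
count-total true  zero    []       = refl
count-total b     (suc k) []       = refl
count-total b     zero    (x ∷ xs) =
  trans (cong₂ _+_ (count-cons-zero b x xs) (count-cons-zero (not b) x xs)) (count-total b zero xs)
count-total b     (suc k) (x ∷ xs) = begin
  count b (suc k) (x ∷ xs) + count (not b) (suc k) (x ∷ xs)
    ≡⟨ cong₂ _+_ (count-cons-suc b k x xs) (count-cons-suc (not b) k x xs) ⟩
  (count b (suc k) xs + count q k xs) + (count (not b) (suc k) xs + count (odd x xor not b) k xs)
    ≡⟨ cong (λ c → count b (suc k) xs + count q k xs + (count (not b) (suc k) xs + count c k xs))
            (sym (not-distribʳ-xor (odd x) b)) ⟩
  (count b (suc k) xs + count q k xs) + (count (not b) (suc k) xs + count (not q) k xs)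
    ≡⟨ interchange (count b (suc k) xs) _ _ _ ⟩
  (count b (suc k) xs + count (not b) (suc k) xs) + (count q k xs + count (not q) k xs)
    ≡⟨ cong₂ _+_ (count-total b (suc k) xs) (count-total q k xs) ⟩
  length xs C suc k + length xs C k
    ≡⟨ +-comm (length xs C suc k) _ ⟩
  length xs C k + length xs C suc k
    ≡⟨ nCk+nC[k+1]≡[n+1]C[k+1] (length xs) k ⟩
  suc (length xs) C suc k ∎
  where
  q = odd x xor b

count-large : ∀ b k xs → length xs < k → count b k xs ≡ 0
count-large b (suc k) []       _          = refl
count-large b (suc k) (x ∷ xs) (s≤s xs<k) = begin
  count b (suc k) (x ∷ xs)                           ≡⟨ count-cons-suc b k x xs ⟩
  count b (suc k) xs + count (odd x xor b) k xs      ≡⟨ cong₂ _+_ (count-large b (suc k) xs (m<n⇒m<1+n xs<k))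
                                                                  (count-large (odd x xor b) k xs xs<k) ⟩
  0                                                  ∎

count-full : ∀ xs → count (odd (sum xs)) (length xs) xs ≡ 1
count-full []       = refl
count-full (x ∷ xs) = begin
  count p (suc (length xs)) (x ∷ xs)                             ≡⟨ count-cons-suc p (length xs) x xs ⟩
  count p (suc (length xs)) xs + count (odd x xor p) (length xs) xs
    ≡⟨ cong₂ _+_ (count-large p _ xs (n<1+n (length xs))) (cong (λ c → count c (length xs) xs) cancel) ⟩
  count (odd (sum xs)) (length xs) xs                            ≡⟨ count-full xs ⟩
  1                                                              ∎
  where
  p = odd (x + sum xs)
  cancel : odd x xor p ≡ odd (sum xs)
  cancel = trans (cong (odd x xor_) (odd-+ x (sum xs))) (xor-cancel (odd x) (odd (sum xs)))
    where
    xor-cancel : ∀ a c → a xor (a xor c) ≡ c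
    xor-cancel false c = refl
    xor-cancel true  c = not-involutive c

-- Conversely, a count of 1 for the full-size subsets pins down their parity,
-- since the other parity class is then empty.
full-parity : ∀ b xs → count b (length xs) xs ≡ 1 → b ≡ odd (sum xs)
full-parity b xs full with b ≟ᵇ odd (sum xs)
... | yes b≡p = b≡p
... | no  b≢p = contradiction two≡one λ ()
  where
  m = length xs
  p = odd (sum xs)
  two≡one : 2 ≡ 1
  two≡one = begin
    2                             ≡⟨ cong₂ _+_ (sym (count-full xs)) (sym (subst (λ c → count c m xs ≡ 1) (¬-not b≢p) full)) ⟩
    count p m xs + count (not p) m xs ≡⟨ count-total p m xs ⟩
    m C m                         ≡⟨ nCn≡1 m ⟩
    1                             ∎

-- Peeling off two numbers of opposite parity: the (k+2)-subsets containing
-- exactly one of them contribute a full binomial coefficient, and those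
-- containing both are counted with the flipped parity.
count-cons₂ : ∀ b k x y xs → odd x ≡ not (odd y) →
  count b (suc (suc k)) (x ∷ y ∷ xs) ≡ count b (suc (suc k)) xs + length xs C suc k + count (not b) k xs
count-cons₂ b k x y xs opposite = begin
  count b (suc (suc k)) (x ∷ y ∷ xs)
    ≡⟨ count-cons-suc b (suc k) x (y ∷ xs) ⟩
  count b (suc (suc k)) (y ∷ xs) + count (odd x xor b) (suc k) (y ∷ xs)
    ≡⟨ cong₂ _+_ (count-cons-suc b (suc k) y xs) (count-cons-suc (odd x xor b) k y xs) ⟩
  (c₂ + count q (suc k) xs) + (count (odd x xor b) (suc k) xs + count (odd y xor (odd x xor b)) k xs)
    ≡⟨ cong₂ (λ r s → (c₂ + count q (suc k) xs) + (count r (suc k) xs + count s k xs))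
             (opposite-flip b opposite) (opposite-xor b opposite) ⟩
  (c₂ + count q (suc k) xs) + (count (not q) (suc k) xs + count (not b) k xs)
    ≡⟨ regroup c₂ _ _ _ ⟩
  c₂ + (count q (suc k) xs + count (not q) (suc k) xs) + count (not b) k xs
    ≡⟨ cong (λ t → c₂ + t + count (not b) k xs) (count-total q (suc k) xs) ⟩
  c₂ + length xs C suc k + count (not b) k xs ∎
  where
  c₂ = count b (suc (suc k)) xs
  q = odd y xor b
  regroup : ∀ a₁ a₂ a₃ a₄ → (a₁ + a₂) + (a₃ + a₄) ≡ a₁ + (a₂ + a₃) + a₄
  regroup a₁ a₂ a₃ a₄ = trans (sym (+-assoc (a₁ + a₂) a₃ a₄)) (cong (_+ a₄) (+-assoc a₁ a₂ a₃))

-- The same for 1-subsets: the two singletons together contribute one.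
count-cons₂-one : ∀ b x y xs → odd x ≡ not (odd y) →
  count b 1 (x ∷ y ∷ xs) ≡ count b 1 xs + 1
count-cons₂-one b x y xs opposite = begin
  count b 1 (x ∷ y ∷ xs)
    ≡⟨ count-cons-suc b 0 x (y ∷ xs) ⟩
  count b 1 (y ∷ xs) + count (odd x xor b) 0 (y ∷ xs)
    ≡⟨ cong₂ _+_ (count-cons-suc b 0 y xs) (count-cons-zero (odd x xor b) y xs) ⟩
  (count b 1 xs + count q 0 xs) + count (odd x xor b) 0 xs
    ≡⟨ +-assoc (count b 1 xs) _ _ ⟩
  count b 1 xs + (count q 0 xs + count (odd x xor b) 0 xs)
    ≡⟨ cong (λ r → count b 1 xs + (count q 0 xs + count r 0 xs)) (opposite-flip b opposite) ⟩
  count b 1 xs + (count q 0 xs + count (not q) 0 xs)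
    ≡⟨ cong (count b 1 xs +_) (count-total q 0 xs) ⟩
  count b 1 xs + 1 ∎
  where
  q = odd y xor b

length-ground : ∀ n → length (ground n) ≡ n
length-ground zero    = refl
length-ground (suc n) = cong suc (length-ground n)

-- column-parity k : the parity of 1 + ⋯ + k, i.e. of the only k-subset of {1,…,k}.
column-parity : ℕ → Bool
column-parity k = odd (sum (ground k))

column-parity-step : ∀ k → column-parity (suc (suc k)) ≡ not (column-parity k)
column-parity-step k = begin
  odd (suc (suc k) + (suc k + sum (ground k)))          ≡⟨ odd-+ (suc (suc k)) _ ⟩
  odd (suc (suc k)) xor odd (suc k + sum (ground k))    ≡⟨ cong (odd (suc (suc k)) xor_) (odd-+ (suc k) _) ⟩
  odd (suc (suc k)) xor (odd (suc k) xor column-parity k) ≡⟨ opposite-xor {odd (suc k)} (column-parity k) (sym (not-involutive (odd (suc k)))) ⟩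
  not (column-parity k)                                 ∎

ground-diagonal : ∀ n → count (column-parity n) n (ground n) ≡ 1
ground-diagonal n = subst (λ m → count (column-parity n) m (ground n) ≡ 1) (length-ground n) (count-full (ground n))

L-count : ∀ n k → L n k ≡ count (column-parity k) k (ground n)
L-count zero          zero          = refl
L-count zero          (suc k)       = refl
L-count (suc zero)    zero          = refl
L-count (suc zero)    (suc zero)    = refl
L-count (suc zero)    (suc (suc k)) = refl
L-count (suc (suc n)) zero          =
  trans (L-count n 0) (sym (trans (count-cons-zero false (suc (suc n)) (suc n ∷ ground n)) (count-cons-zero false (suc n) (ground n))))
L-count (suc (suc n)) (suc zero)    =
  trans (cong (_+ 1) (L-count n 1)) (sym (count-cons₂-one true (suc (suc n)) (suc n) (ground n) refl))
L-count (suc (suc n)) (suc (suc k)) = sym (begin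
  count b (suc (suc k)) (suc (suc n) ∷ suc n ∷ ground n)
    ≡⟨ count-cons₂ b k (suc (suc n)) (suc n) (ground n) refl ⟩
  count b (suc (suc k)) (ground n) + length (ground n) C suc k + count (not b) k (ground n)
    ≡⟨ cong₂ _+_ (cong₂ _+_ (sym (L-count n (suc (suc k)))) (cong (_C suc k) (length-ground n))) previous-column ⟩
  L n (suc (suc k)) + n C suc k + L n k ∎)
  where
  b = column-parity (suc (suc k))
  previous-column : count (not b) k (ground n) ≡ L n k
  previous-column = begin
    count (not b) k (ground n)                       ≡⟨ cong (λ c → count (not c) k (ground n)) (column-parity-step k) ⟩
    count (not (not (column-parity k))) k (ground n) ≡⟨ cong (λ c → count c k (ground n)) (not-involutive _) ⟩
    count (column-parity k) k (ground n)             ≡⟨ L-count n k ⟨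
    L n k                                            ∎

IsColumn : (ℕ → ℕ → ℕ) → ℕ → Bool → Set
IsColumn a k b = ∀ n → a n k ≡ count b k (ground n)

isColumn⇒eo : ∀ {a k} b → IsColumn a k b → (∀ n → a n k ≡ e n k) ⊎ (∀ n → a n k ≡ o n k)
isColumn⇒eo false column = inj₁ column
isColumn⇒eo true  column = inj₂ column

eo⇒isColumn : ∀ {a k} → (∀ n → a n k ≡ e n k) ⊎ (∀ n → a n k ≡ o n k) → Σ Bool (IsColumn a k)
eo⇒isColumn (inj₁ even-column) = false , even-column
eo⇒isColumn (inj₂ odd-column)  = true  , odd-column

-- Uniqueness: the diagonal entry a k k = 1 forces column k of a to have the
-- parity of column k of L, so the two columns coincide.
L-unique : ∀ (a : ℕ → ℕ → ℕ) → ColumnsEO a → DiagOne a → ∀ n k → a n k ≡ L n k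
L-unique a eo diag n k with eo⇒isColumn {a} {k} (eo k)
... | b , column = begin
  a n k                                  ≡⟨ column n ⟩
  count b k (ground n)                   ≡⟨ cong (λ c → count c k (ground n)) forced ⟩
  count (column-parity k) k (ground n)   ≡⟨ L-count n k ⟨
  L n k                                  ∎
  where
  full : count b (length (ground k)) (ground k) ≡ 1
  full = subst (λ m → count b m (ground k) ≡ 1) (sym (length-ground k)) (trans (sym (column k)) (diag k))
  forced : b ≡ column-parity k
  forced = full-parity b (ground k) full

proposition3p1 : (ColumnsEO L × DiagOne L)
    × (∀ (a : ℕ → ℕ → ℕ) → ColumnsEO a → DiagOne a → ∀ n k → a n k ≡ L n k)
proposition3p1 = (columns , diagonal) , L-unique
  where
  columns : ColumnsEO L
  columns k = isColumn⇒eo {L} {k} (column-parity k) (λ n → L-count n k)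

  diagonal : DiagOne L
  diagonal n = trans (L-count n n) (ground-diagonal n)
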